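{- $\mathsf{G}\,\mathrm{FO}_{\mathrm{qf}}(<)=\mathsf{G}\,\mathrm{FO}_{\mathrm{qf}}(<,+)=\mathsf{G}\,\mathrm{FO}_{\mathrm{qf}}(<,\times)$.
   Context: Graphs are finite directed graphs (possibly with self-loops); a graph class is a set of finite graphs closed under isomorphism. For $n\ge1$, $\mathcal{N}_n$ is the structure with universe $[n]_0=\{0,\dots,n\}$, the usual order $<$, and addition and multiplication defined as usual if the result is $\le n$ and as $0$ otherwise. For $\sigma\subseteq\{<,+,\times\}$, $\mathrm{FO}_k(\sigma)$ denotes first-order formulas with $k$ free variables using $\neg,\vee,\wedge$, quantifiers, equality and the symbols of $\sigma$. A logical labeling scheme is $(\varphi,c)$ with $\varphi\in\mathrm{FO}_{2k}(\sigma)$, $c,k\in\mathbb{N}$; a graph $G$ with $n$ vertices is in $\mathrm{gr}(\varphi,c)$ if there is $\ell\colon V(G)\to[n^c]_0^k$ with $(u,v)\in E(G)\iff\mathcal{N}_{n^c},(\ell(u),\ell(v))\models\varphi$ for all $u,v\in V(G)$. $\mathsf{G}\,\mathrm{FO}_{\mathrm{qf}}(\sigma)$ is the set of graph classes $\mathcal{C}$ such that $\mathcal{C}\subseteq\mathrm{gr}(\varphi,c)$ for some quantifier-free $\varphi\in\mathrm{FO}_{2k}(\sigma)$ and $c,k\in\mathbb{N}$. -}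

module Defs where

open import Data.Nat using (ℕ; zero; suc; _+_; _*_; _^_; _≤ᵇ_; _<ᵇ_; _≡ᵇ_)
open import Data.Bool using (Bool; true; false; not; _∧_; _∨_; if_then_else_; T)
open import Data.Fin using (Fin; toℕ; splitAt)
open import Data.Sum using (_⊎_; inj₁; inj₂)
open import Data.Product using (Σ; ∃; _×_; _,_)
open import Function.Definitions using (Bijective)
open import Function.Bundles using (_⇔_)
open import Relation.Binary.PropositionalEquality using (_≡_)

record Graph : Set where
  field
    size : ℕ
    edge : Fin size → Fin size → Bool

open Graph public

_≅_ : Graph → Graph → Set
G ≅ H = Σ (Fin (size G) → Fin (size H)) λ f →
          Bijective _≡_ _≡_ f × (∀ u v → edge G u v ≡ edge H (f u) (f v))

IsoClosed : (Graph → Set) → Set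
IsoClosed C = ∀ G H → G ≅ H → C G → C H

record Sig : Set where
  field
    hasLt hasPlus hasTimes : Bool

open Sig public

σ< σ<+ σ<× : Sig
σ< = record { hasLt = true ; hasPlus = false ; hasTimes = false }
σ<+ = record { hasLt = true ; hasPlus = true ; hasTimes = false }
σ<× = record { hasLt = true ; hasPlus = false ; hasTimes = true }

data Term (σ : Sig) (m : ℕ) : Set where
  var   : Fin m → Term σ m
  plus  : T (hasPlus σ) → Term σ m → Term σ m → Term σ m
  times : T (hasTimes σ) → Term σ m → Term σ m → Term σ m

data QF (σ : Sig) (m : ℕ) : Set where
  eq  : Term σ m → Term σ m → QF σ m
  lt  : T (hasLt σ) → Term σ m → Term σ m → QF σ m
  neg : QF σ m → QF σ m
  or  : QF σ m → QF σ m → QF σ m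
  and : QF σ m → QF σ m → QF σ m

-- Semantics in 𝒩_N: universe {0,…,N}, truncated + and × (result 0 if > N).

truncOp : ℕ → ℕ → ℕ
truncOp N r = if r ≤ᵇ N then r else 0

evalTerm : ∀ {σ m} → (N : ℕ) → (Fin m → ℕ) → Term σ m → ℕ
evalTerm N ρ (var i) = ρ i
evalTerm N ρ (plus _ s t) = truncOp N (evalTerm N ρ s + evalTerm N ρ t)
evalTerm N ρ (times _ s t) = truncOp N (evalTerm N ρ s * evalTerm N ρ t)

evalQF : ∀ {σ m} → (N : ℕ) → (Fin m → ℕ) → QF σ m → Bool
evalQF N ρ (eq s t) = evalTerm N ρ s ≡ᵇ evalTerm N ρ t
evalQF N ρ (lt _ s t) = evalTerm N ρ s <ᵇ evalTerm N ρ t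
evalQF N ρ (neg φ) = not (evalQF N ρ φ)
evalQF N ρ (or φ ψ) = evalQF N ρ φ ∨ evalQF N ρ ψ
evalQF N ρ (and φ ψ) = evalQF N ρ φ ∧ evalQF N ρ ψ

pairAssign : ∀ {N} k → (Fin k → Fin (suc N)) → (Fin k → Fin (suc N)) → Fin (k + k) → ℕ
pairAssign k x y i with splitAt k i
... | inj₁ j = toℕ (x j)
... | inj₂ j = toℕ (y j)

InGr : ∀ {σ} k → QF σ (k + k) → ℕ → Graph → Set
InGr k φ c G =
  Σ (Fin (size G) → Fin k → Fin (suc (size G ^ c))) λ ℓ →
    ∀ u v → edge G u v ≡ evalQF (size G ^ c) (pairAssign k (ℓ u) (ℓ v)) φ

InGFOqf : Sig → (Graph → Set) → Set
InGFOqf σ C = Σ ℕ λ k → Σ (QF σ (k + k)) λ φ → Σ ℕ λ c →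
                ∀ G → C G → InGr k φ c G

-- Let φ be a quantifier-free formula over < and + (or ×) evaluated on labels x, y ∈ [N]₀ᵏ of
-- two vertices. After finitely many case distinctions every term of φ takes the form a(x) + b(y)
-- (resp. a(x) · b(y)) with a, b polynomially bounded in N, and every case distinction and atomic
-- comparison is a Boolean combination of comparisons f(x) < g(y) and f(x) = g(y). For sums,
-- a(x) + b(y) < a′(x) + b′(y) iff a(x) + (K − a′(x)) < b′(y) + (K − b(y)) for a large offset K;
-- for products, a(x) b(y) < a′(x) b′(y) compares the fractions a / a′ and b′ / b, whose floors
-- after scaling by (N + 1)² are ordered like the fractions. The numbers f(x), g(x) become the
-- new labels of a vertex, bounded by a fixed power of n once n ≥ 2; one-vertex graphs are
-- handled by two flag labels.

module Submission where

open import Defs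
open import Data.Product using (_×_)
open import Function.Bundles using (_⇔_; mk⇔; Equivalence)

open import Data.Bool using (Bool; true; false; not; _∧_; _∨_; if_then_else_; T)
open import Data.Bool.Properties using (∨-identityʳ; T-≡)
open import Data.Empty using (⊥-elim)
open import Data.Fin using (Fin; toℕ; splitAt; _↑ˡ_; _↑ʳ_; fromℕ<)
open import Data.Fin.Properties using (toℕ-fromℕ<; toℕ<n)
open import Data.Nat
  using (ℕ; zero; suc; _+_; _*_; _^_; _∸_; _≤_; _<_; _≤ᵇ_; _<ᵇ_; _≡ᵇ_; _⊓_; _⊔_; z≤n; s≤s; NonZero; _/_; _≤?_)
open import Data.Nat.DivMod using (m/n*n≤m; m/n≤m; m*n/n≡m; /-monoˡ-≤)
open import Data.Nat.Properties
open import Data.Nat.Tactic.RingSolver using (solve-∀)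
open import Algebra.Properties.CommutativeSemigroup +-commutativeSemigroup using () renaming (interchange to +-interchange)
open import Algebra.Properties.CommutativeSemigroup *-commutativeSemigroup using () renaming (interchange to *-interchange)
open import Data.Product using (_,_; map₂)
open import Data.Sum using (_⊎_; inj₁; inj₂; [_,_]′) renaming (map to ⊎-map)
open import Data.Sum.Properties using ([,]-cong)
open import Data.Vec.Functional using (_++_)
open import Data.Vec.Functional.Properties using (lookup-++ˡ; lookup-++ʳ)
open import Data.Unit using (tt)
open import Function using (_∘_)
open import Relation.Binary.Definitions using (tri<; tri≈; tri>)
open import Relation.Binary.PropositionalEquality
open import Relation.Nullary using (yes; no)

T-injective : ∀ {a b : Bool} → (T a → T b) → (T b → T a) → a ≡ b
T-injective {false} {false} _ _ = refl
T-injective {false} {true}  _ g = ⊥-elim (g tt)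
T-injective {true}  {false} f _ = ⊥-elim (f tt)
T-injective {true}  {true}  _ _ = refl

if-distribˡ : (R : ℕ → ℕ → Bool) (p : Bool) (a b z : ℕ) →
  R (if p then a else b) z ≡ (p ∧ R a z) ∨ (not p ∧ R b z)
if-distribˡ R true  a b z = sym (∨-identityʳ _)
if-distribˡ R false a b z = refl

if-distribʳ : (R : ℕ → ℕ → Bool) (p : Bool) (a b z : ℕ) →
  R z (if p then a else b) ≡ (p ∧ R z a) ∨ (not p ∧ R z b)
if-distribʳ R true  a b z = sym (∨-identityʳ _)
if-distribʳ R false a b z = refl

data OrderFormula (V : Set) : Set where
  lt eq   : V → V → OrderFormula V
  neg     : OrderFormula V → OrderFormula V
  or and  : OrderFormula V → OrderFormula V → OrderFormula V

evalOrd : ∀ {V : Set} → (V → ℕ) → OrderFormula V → Bool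
evalOrd ρ (lt a b)  = ρ a <ᵇ ρ b
evalOrd ρ (eq a b)  = ρ a ≡ᵇ ρ b
evalOrd ρ (neg ψ)   = not (evalOrd ρ ψ)
evalOrd ρ (or ψ χ)  = evalOrd ρ ψ ∨ evalOrd ρ χ
evalOrd ρ (and ψ χ) = evalOrd ρ ψ ∧ evalOrd ρ χ

rename : ∀ {V W : Set} → (V → W) → OrderFormula V → OrderFormula W
rename f (lt a b)  = lt (f a) (f b)
rename f (eq a b)  = eq (f a) (f b)
rename f (neg ψ)   = neg (rename f ψ)
rename f (or ψ χ)  = or (rename f ψ) (rename f χ)
rename f (and ψ χ) = and (rename f ψ) (rename f χ)

evalOrd-cong : ∀ {V : Set} {ρ ρ′ : V → ℕ} → (∀ v → ρ v ≡ ρ′ v) →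
  ∀ ψ → evalOrd ρ ψ ≡ evalOrd ρ′ ψ
evalOrd-cong h (lt a b)  = cong₂ _<ᵇ_ (h a) (h b)
evalOrd-cong h (eq a b)  = cong₂ _≡ᵇ_ (h a) (h b)
evalOrd-cong h (neg ψ)   = cong not (evalOrd-cong h ψ)
evalOrd-cong h (or ψ χ)  = cong₂ _∨_ (evalOrd-cong h ψ) (evalOrd-cong h χ)
evalOrd-cong h (and ψ χ) = cong₂ _∧_ (evalOrd-cong h ψ) (evalOrd-cong h χ)

evalOrd-rename : ∀ {V W : Set} (ρ : W → ℕ) (f : V → W) ψ →
  evalOrd ρ (rename f ψ) ≡ evalOrd (ρ ∘ f) ψ
evalOrd-rename ρ f (lt a b)  = refl
evalOrd-rename ρ f (eq a b)  = refl
evalOrd-rename ρ f (neg ψ)   = cong not (evalOrd-rename ρ f ψ)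
evalOrd-rename ρ f (or ψ χ)  = cong₂ _∨_ (evalOrd-rename ρ f ψ) (evalOrd-rename ρ f χ)
evalOrd-rename ρ f (and ψ χ) = cong₂ _∧_ (evalOrd-rename ρ f ψ) (evalOrd-rename ρ f χ)

evalOrd-rename-++ˡ : ∀ {a a′ b b′} (A : Fin a → ℕ) (A′ : Fin a′ → ℕ) (B : Fin b → ℕ) (B′ : Fin b′ → ℕ) ψ →
  evalOrd [ A ++ A′ , B ++ B′ ]′ (rename (⊎-map (_↑ˡ a′) (_↑ˡ b′)) ψ) ≡ evalOrd [ A , B ]′ ψ
evalOrd-rename-++ˡ A A′ B B′ ψ = trans (evalOrd-rename _ _ ψ) (evalOrd-cong lookup ψ)
  where
    lookup : ∀ v → [ A ++ A′ , B ++ B′ ]′ (⊎-map (_↑ˡ _) (_↑ˡ _) v) ≡ [ A , B ]′ v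
    lookup (inj₁ i) = lookup-++ˡ A A′ i
    lookup (inj₂ i) = lookup-++ˡ B B′ i

evalOrd-rename-++ʳ : ∀ {a a′ b b′} (A : Fin a → ℕ) (A′ : Fin a′ → ℕ) (B : Fin b → ℕ) (B′ : Fin b′ → ℕ) ψ →
  evalOrd [ A ++ A′ , B ++ B′ ]′ (rename (⊎-map (a ↑ʳ_) (b ↑ʳ_)) ψ) ≡ evalOrd [ A′ , B′ ]′ ψ
evalOrd-rename-++ʳ A A′ B B′ ψ = trans (evalOrd-rename _ _ ψ) (evalOrd-cong lookup ψ)
  where
    lookup : ∀ v → [ A ++ A′ , B ++ B′ ]′ (⊎-map (_ ↑ʳ_) (_ ↑ʳ_) v) ≡ [ A′ , B′ ]′ v
    lookup (inj₁ i) = lookup-++ʳ A A′ i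
    lookup (inj₂ i) = lookup-++ʳ B B′ i

toQF : ∀ {m} → OrderFormula (Fin m) → QF σ< m
toQF (lt a b)  = lt tt (var a) (var b)
toQF (eq a b)  = eq (var a) (var b)
toQF (neg ψ)   = neg (toQF ψ)
toQF (or ψ χ)  = or (toQF ψ) (toQF χ)
toQF (and ψ χ) = and (toQF ψ) (toQF χ)

evalQF-toQF : ∀ {m} N (ρ : Fin m → ℕ) ψ → evalQF N ρ (toQF ψ) ≡ evalOrd ρ ψ
evalQF-toQF N ρ (lt a b)  = refl
evalQF-toQF N ρ (eq a b)  = refl
evalQF-toQF N ρ (neg ψ)   = cong not (evalQF-toQF N ρ ψ)
evalQF-toQF N ρ (or ψ χ)  = cong₂ _∨_ (evalQF-toQF N ρ ψ) (evalQF-toQF N ρ χ)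
evalQF-toQF N ρ (and ψ χ) = cong₂ _∧_ (evalQF-toQF N ρ ψ) (evalQF-toQF N ρ χ)

evalTerm-cong : ∀ {σ m} N {ρ ρ′ : Fin m → ℕ} → (∀ i → ρ i ≡ ρ′ i) →
  (t : Term σ m) → evalTerm N ρ t ≡ evalTerm N ρ′ t
evalTerm-cong N h (var i)       = h i
evalTerm-cong N h (plus _ s t)  = cong (truncOp N) (cong₂ _+_ (evalTerm-cong N h s) (evalTerm-cong N h t))
evalTerm-cong N h (times _ s t) = cong (truncOp N) (cong₂ _*_ (evalTerm-cong N h s) (evalTerm-cong N h t))

evalQF-cong : ∀ {σ m} N {ρ ρ′ : Fin m → ℕ} → (∀ i → ρ i ≡ ρ′ i) →
  (φ : QF σ m) → evalQF N ρ φ ≡ evalQF N ρ′ φ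
evalQF-cong N h (eq s t)   = cong₂ _≡ᵇ_ (evalTerm-cong N h s) (evalTerm-cong N h t)
evalQF-cong N h (lt _ s t) = cong₂ _<ᵇ_ (evalTerm-cong N h s) (evalTerm-cong N h t)
evalQF-cong N h (neg φ)    = cong not (evalQF-cong N h φ)
evalQF-cong N h (or φ ψ)   = cong₂ _∨_ (evalQF-cong N h φ) (evalQF-cong N h ψ)
evalQF-cong N h (and φ ψ)  = cong₂ _∧_ (evalQF-cong N h φ) (evalQF-cong N h ψ)

liftTerm : ∀ {m} σ → Term σ< m → Term σ m
liftTerm σ (var i) = var i

liftQF : ∀ {m} σ → T (hasLt σ) → QF σ< m → QF σ m
liftQF σ h (eq s t)   = eq (liftTerm σ s) (liftTerm σ t)
liftQF σ h (lt _ s t) = lt h (liftTerm σ s) (liftTerm σ t)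
liftQF σ h (neg φ)    = neg (liftQF σ h φ)
liftQF σ h (or φ ψ)   = or (liftQF σ h φ) (liftQF σ h ψ)
liftQF σ h (and φ ψ)  = and (liftQF σ h φ) (liftQF σ h ψ)

evalTerm-liftTerm : ∀ {m} σ N (ρ : Fin m → ℕ) t → evalTerm N ρ (liftTerm σ t) ≡ evalTerm N ρ t
evalTerm-liftTerm σ N ρ (var i) = refl

evalQF-liftQF : ∀ {m} σ h N (ρ : Fin m → ℕ) φ → evalQF N ρ (liftQF σ h φ) ≡ evalQF N ρ φ
evalQF-liftQF σ h N ρ (eq s t)   = cong₂ _≡ᵇ_ (evalTerm-liftTerm σ N ρ s) (evalTerm-liftTerm σ N ρ t)
evalQF-liftQF σ h N ρ (lt _ s t) = cong₂ _<ᵇ_ (evalTerm-liftTerm σ N ρ s) (evalTerm-liftTerm σ N ρ t)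
evalQF-liftQF σ h N ρ (neg φ)    = cong not (evalQF-liftQF σ h N ρ φ)
evalQF-liftQF σ h N ρ (or φ ψ)   = cong₂ _∨_ (evalQF-liftQF σ h N ρ φ) (evalQF-liftQF σ h N ρ ψ)
evalQF-liftQF σ h N ρ (and φ ψ)  = cong₂ _∧_ (evalQF-liftQF σ h N ρ φ) (evalQF-liftQF σ h N ρ ψ)

InGFOqf-σ<⇒ : ∀ σ → T (hasLt σ) → (C : Graph → Set) → InGFOqf σ< C → InGFOqf σ C
InGFOqf-σ<⇒ σ h C (k , φ , c , inGr) = k , liftQF σ h φ , c , λ G g →
  map₂ (λ edge≡ u v → trans (edge≡ u v) (sym (evalQF-liftQF σ h _ _ φ))) (inGr G g)

++-bounded : ∀ {a b M} (A : Fin a → ℕ) (B : Fin b → ℕ) →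
  (∀ i → A i ≤ M) → (∀ i → B i ≤ M) → ∀ i → (A ++ B) i ≤ M
++-bounded {a} A B hA hB i with splitAt a i
... | inj₁ j = hA j
... | inj₂ j = hB j

pairAssign≗++ : ∀ {N} k (a b : Fin k → Fin (suc N)) i → pairAssign k a b i ≡ ((toℕ ∘ a) ++ (toℕ ∘ b)) i
pairAssign≗++ k a b i with splitAt k i
... | inj₁ j = refl
... | inj₂ j = refl

InGr-toQF : ∀ {m} (ψ : OrderFormula (Fin (m + m))) c G (R : Fin (size G) → Fin m → ℕ) →
  (∀ u j → R u j ≤ size G ^ c) → (∀ u v → edge G u v ≡ evalOrd (R u ++ R v) ψ) →
  InGr m (toQF ψ) c G
InGr-toQF {m} ψ c G R R≤ edge≡ = ℓ , λ u v → begin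
  edge G u v                                               ≡⟨ edge≡ u v ⟩
  evalOrd (R u ++ R v) ψ                                   ≡⟨ evalOrd-cong (toℕ∘ℓ u v) ψ ⟨
  evalOrd (pairAssign m (ℓ u) (ℓ v)) ψ                     ≡⟨ evalQF-toQF (size G ^ c) _ ψ ⟨
  evalQF (size G ^ c) (pairAssign m (ℓ u) (ℓ v)) (toQF ψ)  ∎
  where
    open ≡-Reasoning
    ℓ : Fin (size G) → Fin m → Fin (suc (size G ^ c))
    ℓ u j = fromℕ< (s≤s (R≤ u j))
    toℕ∘ℓ : ∀ u v i → pairAssign m (ℓ u) (ℓ v) i ≡ (R u ++ R v) i
    toℕ∘ℓ u v i = trans (pairAssign≗++ m (ℓ u) (ℓ v) i)
      ([,]-cong (λ j → toℕ-fromℕ< (s≤s (R≤ u j))) (λ j → toℕ-fromℕ< (s≤s (R≤ v j))) (splitAt m i))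

1+n^c≤n^[1+c] : ∀ n c → 2 ≤ n → suc (n ^ c) ≤ n ^ suc c
1+n^c≤n^[1+c] n c 2≤n@(s≤s (s≤s _)) = begin
  suc (n ^ c)      ≤⟨ +-monoˡ-≤ (n ^ c) (m^n>0 n c) ⟩
  n ^ c + n ^ c    ≡⟨ cong (n ^ c +_) (+-identityʳ (n ^ c)) ⟨
  2 * n ^ c        ≤⟨ *-monoˡ-≤ (n ^ c) 2≤n ⟩
  n ^ suc c        ∎
  where open ≤-Reasoning

[1+n^c]^e≤n^[1+c]e : ∀ n c e → 2 ≤ n → suc (n ^ c) ^ e ≤ n ^ (suc c * e)
[1+n^c]^e≤n^[1+c]e n c e 2≤n =
  ≤-trans (^-monoˡ-≤ e (1+n^c≤n^[1+c] n c 2≤n)) (≤-reflexive (^-*-assoc n (suc c) e))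

+-≤-[1+N]^[1+e] : ∀ N e {p q} → 1 ≤ N → p ≤ suc N ^ e → q ≤ suc N ^ e → p + q ≤ suc N ^ suc e
+-≤-[1+N]^[1+e] N e {p} {q} 1≤N p≤ q≤ = begin
  p + q                          ≤⟨ +-mono-≤ p≤ q≤ ⟩
  suc N ^ e + suc N ^ e          ≡⟨ cong (suc N ^ e +_) (*-identityˡ (suc N ^ e)) ⟨
  suc N ^ e + 1 * suc N ^ e      ≤⟨ +-monoʳ-≤ (suc N ^ e) (*-monoˡ-≤ (suc N ^ e) 1≤N) ⟩
  suc N ^ suc e                  ∎
  where open ≤-Reasoning

1+N≤[1+N]^[1+e] : ∀ N e → suc N ≤ suc N ^ suc e
1+N≤[1+N]^[1+e] N e = ≤-trans (≤-reflexive (sym (^-identityʳ (suc N)))) (^-monoʳ-≤ (suc N) {1} {suc e} (s≤s z≤n))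

-- Separable relations

module Separation (k : ℕ) where

  Labels : Set
  Labels = Fin k → ℕ

  Bounded : ℕ → Labels → Set
  Bounded N x = ∀ i → x i ≤ N

  InRange : ℕ → Labels → Labels → Set
  InRange N x y = 1 ≤ N × Bounded N x × Bounded N y

  Relation : Set
  Relation = ℕ → Labels → Labels → Bool

  PolyBounded : (ℕ → Labels → ℕ) → ℕ → Set
  PolyBounded f e = ∀ N x → 1 ≤ N → Bounded N x → f N x ≤ suc N ^ e

  PolyBounded-mono : ∀ {f e e′} → e ≤ e′ → PolyBounded f e → PolyBounded f e′
  PolyBounded-mono e≤e′ hf N x h bd = ≤-trans (hf N x h bd) (^-monoʳ-≤ (suc N) e≤e′)

  PolyBounded-+ : ∀ {f g} e → PolyBounded f e → PolyBounded g e → PolyBounded (λ N x → f N x + g N x) (suc e)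
  PolyBounded-+ e hf hg N x h bd = +-≤-[1+N]^[1+e] N e h (hf N x h bd) (hg N x h bd)

  PolyBounded-var : ∀ j → PolyBounded (λ N x → x j) 1
  PolyBounded-var j N x _ bd = ≤-trans (bd j) (≤-trans (n≤1+n N) (1+N≤[1+N]^[1+e] N 0))

  record Separable (P : Relation) : Set where
    field
      arityˡ arityʳ degree : ℕ
      formula : OrderFormula (Fin arityˡ ⊎ Fin arityʳ)
      labelˡ : ℕ → Labels → Fin arityˡ → ℕ
      labelʳ : ℕ → Labels → Fin arityʳ → ℕ
      labelˡ-bounded : ∀ i → PolyBounded (λ N x → labelˡ N x i) degree
      labelʳ-bounded : ∀ i → PolyBounded (λ N y → labelʳ N y i) degree
      sound : ∀ N x y → InRange N x y → P N x y ≡ evalOrd [ labelˡ N x , labelʳ N y ]′ formula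

  separable-cong : ∀ {P Q} → (∀ N x y → InRange N x y → Q N x y ≡ P N x y) → Separable P → Separable Q
  separable-cong Q≡P s = record { Separable s; sound = λ N x y r → trans (Q≡P N x y r) (sound N x y r) }
    where open Separable s

  separable-not : ∀ {P} → Separable P → Separable (λ N x y → not (P N x y))
  separable-not s = record { Separable s; formula = neg formula; sound = λ N x y r → cong not (sound N x y r) }
    where open Separable s

  separable-op : ∀ {P Q} (op : Bool → Bool → Bool) (con : ∀ {V : Set} → OrderFormula V → OrderFormula V → OrderFormula V) →
    (∀ {V : Set} (ρ : V → ℕ) ψ χ → evalOrd ρ (con ψ χ) ≡ op (evalOrd ρ ψ) (evalOrd ρ χ)) →
    Separable P → Separable Q → Separable (λ N x y → op (P N x y) (Q N x y))
  separable-op {P} {Q} op con evalOrd-con sP sQ = record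
    { arityˡ = SP.arityˡ + SQ.arityˡ
    ; arityʳ = SP.arityʳ + SQ.arityʳ
    ; degree = E
    ; formula = formula
    ; labelˡ = λ N x → SP.labelˡ N x ++ SQ.labelˡ N x
    ; labelʳ = λ N y → SP.labelʳ N y ++ SQ.labelʳ N y
    ; labelˡ-bounded = λ i N x h bd → ++-bounded (SP.labelˡ N x) (SQ.labelˡ N x)
        (λ j → PolyBounded-mono (m≤m⊔n SP.degree SQ.degree) (SP.labelˡ-bounded j) N x h bd)
        (λ j → PolyBounded-mono (m≤n⊔m SP.degree SQ.degree) (SQ.labelˡ-bounded j) N x h bd) i
    ; labelʳ-bounded = λ i N y h bd → ++-bounded (SP.labelʳ N y) (SQ.labelʳ N y)
        (λ j → PolyBounded-mono (m≤m⊔n SP.degree SQ.degree) (SP.labelʳ-bounded j) N y h bd)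
        (λ j → PolyBounded-mono (m≤n⊔m SP.degree SQ.degree) (SQ.labelʳ-bounded j) N y h bd) i
    ; sound = sound
    }
    where
      module SP = Separable sP
      module SQ = Separable sQ
      E = SP.degree ⊔ SQ.degree
      formula : OrderFormula (Fin (SP.arityˡ + SQ.arityˡ) ⊎ Fin (SP.arityʳ + SQ.arityʳ))
      formula = con (rename (⊎-map (_↑ˡ SQ.arityˡ) (_↑ˡ SQ.arityʳ)) SP.formula)
                    (rename (⊎-map (SP.arityˡ ↑ʳ_) (SP.arityʳ ↑ʳ_)) SQ.formula)
      sound : ∀ N x y → InRange N x y →
        op (P N x y) (Q N x y) ≡ evalOrd [ SP.labelˡ N x ++ SQ.labelˡ N x , SP.labelʳ N y ++ SQ.labelʳ N y ]′ formula
      sound N x y r = begin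
        op (P N x y) (Q N x y)
          ≡⟨ cong₂ op (SP.sound N x y r) (SQ.sound N x y r) ⟩
        op (evalOrd [ SP.labelˡ N x , SP.labelʳ N y ]′ SP.formula) (evalOrd [ SQ.labelˡ N x , SQ.labelʳ N y ]′ SQ.formula)
          ≡⟨ cong₂ op (evalOrd-rename-++ˡ _ (SQ.labelˡ N x) _ (SQ.labelʳ N y) SP.formula)
                      (evalOrd-rename-++ʳ (SP.labelˡ N x) _ (SP.labelʳ N y) _ SQ.formula) ⟨
        op (evalOrd ρ (rename (⊎-map (_↑ˡ SQ.arityˡ) (_↑ˡ SQ.arityʳ)) SP.formula))
           (evalOrd ρ (rename (⊎-map (SP.arityˡ ↑ʳ_) (SP.arityʳ ↑ʳ_)) SQ.formula))
          ≡⟨ evalOrd-con ρ _ _ ⟨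
        evalOrd ρ formula ∎
        where
          open ≡-Reasoning
          ρ = [ SP.labelˡ N x ++ SQ.labelˡ N x , SP.labelʳ N y ++ SQ.labelʳ N y ]′

  separable-∧ : ∀ {P Q} → Separable P → Separable Q → Separable (λ N x y → P N x y ∧ Q N x y)
  separable-∧ = separable-op _∧_ and (λ _ _ _ → refl)

  separable-∨ : ∀ {P Q} → Separable P → Separable Q → Separable (λ N x y → P N x y ∨ Q N x y)
  separable-∨ = separable-op _∨_ or (λ _ _ _ → refl)

  separable-atom : ∀ (con : ∀ {V : Set} → V → V → OrderFormula V) (a b : ℕ → Labels → ℕ) e →
    PolyBounded a e → PolyBounded b e → Separable (λ N x y → evalOrd [ (λ _ → a N x) , (λ _ → b N y) ]′ (con (inj₁ (Fin.zero {0})) (inj₂ Fin.zero)))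
  separable-atom con a b e ha hb = record
    { arityˡ = 1 ; arityʳ = 1 ; degree = e
    ; formula = con (inj₁ Fin.zero) (inj₂ Fin.zero)
    ; labelˡ = λ N x _ → a N x ; labelʳ = λ N y _ → b N y
    ; labelˡ-bounded = λ _ → ha ; labelʳ-bounded = λ _ → hb
    ; sound = λ _ _ _ _ → refl
    }

  separable-< : ∀ (a b : ℕ → Labels → ℕ) e → PolyBounded a e → PolyBounded b e →
    Separable (λ N x y → a N x <ᵇ b N y)
  separable-< = separable-atom lt

  separable-≡ : ∀ (a b : ℕ → Labels → ℕ) e → PolyBounded a e → PolyBounded b e →
    Separable (λ N x y → a N x ≡ᵇ b N y)
  separable-≡ = separable-atom eq

  -- A split value denotes a(x) ⊙ b(y) with a, b polynomially bounded; the truncated operation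
  -- maps split values to split values up to a separable case distinction.
  record SplitModel (σ : Sig) : Set₁ where
    field
      _⊙_          : ℕ → ℕ → ℕ
      plus-is-⊙    : T (hasPlus σ) → ∀ a b → a + b ≡ a ⊙ b
      times-is-⊙   : T (hasTimes σ) → ∀ a b → a * b ≡ a ⊙ b
      Split        : Set
      ⟦_⟧          : Split → ℕ → Labels → Labels → ℕ
      varˡ varʳ    : Fin k → Split
      ⟦varˡ⟧       : ∀ j N x y → ⟦ varˡ j ⟧ N x y ≡ x j
      ⟦varʳ⟧       : ∀ j N x y → ⟦ varʳ j ⟧ N x y ≡ y j
      0ˢ           : Split
      ⟦0ˢ⟧         : ∀ N x y → ⟦ 0ˢ ⟧ N x y ≡ 0
      _⊙ˢ_         : Split → Split → Split
      fits         : Split → Split → Relation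
      fits-separable : ∀ s t → Separable (fits s t)
      truncOp-⊙    : ∀ s t N x y → InRange N x y →
        truncOp N (⟦ s ⟧ N x y ⊙ ⟦ t ⟧ N x y) ≡ (if fits s t N x y then ⟦ s ⊙ˢ t ⟧ N x y else 0)
      <-separable  : ∀ s t → Separable (λ N x y → ⟦ s ⟧ N x y <ᵇ ⟦ t ⟧ N x y)
      ≡-separable  : ∀ s t → Separable (λ N x y → ⟦ s ⟧ N x y ≡ᵇ ⟦ t ⟧ N x y)

  module Piecewise {σ} (M : SplitModel σ) where
    open SplitModel M

    data Piecewise : Set where
      leaf   : Split → Piecewise
      branch : (P : Relation) → Separable P → Piecewise → Piecewise → Piecewise

    ⟦_⟧ᵖ : Piecewise → ℕ → Labels → Labels → ℕ
    ⟦ leaf s ⟧ᵖ N x y         = ⟦ s ⟧ N x y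
    ⟦ branch P _ p q ⟧ᵖ N x y = if P N x y then ⟦ p ⟧ᵖ N x y else ⟦ q ⟧ᵖ N x y

    _⊙ᵖ_ : Piecewise → Piecewise → Piecewise
    branch P sP p q ⊙ᵖ r = branch P sP (p ⊙ᵖ r) (q ⊙ᵖ r)
    leaf s ⊙ᵖ branch P sP p q = branch P sP (leaf s ⊙ᵖ p) (leaf s ⊙ᵖ q)
    leaf s ⊙ᵖ leaf t = branch (fits s t) (fits-separable s t) (leaf (s ⊙ˢ t)) (leaf 0ˢ)

    ⟦⊙ᵖ⟧ : ∀ p q N x y → InRange N x y → ⟦ p ⊙ᵖ q ⟧ᵖ N x y ≡ truncOp N (⟦ p ⟧ᵖ N x y ⊙ ⟦ q ⟧ᵖ N x y)
    ⟦⊙ᵖ⟧ (branch P _ p q) r N x y inR with P N x y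
    ... | true  = ⟦⊙ᵖ⟧ p r N x y inR
    ... | false = ⟦⊙ᵖ⟧ q r N x y inR
    ⟦⊙ᵖ⟧ (leaf s) (branch P _ p q) N x y inR with P N x y
    ... | true  = ⟦⊙ᵖ⟧ (leaf s) p N x y inR
    ... | false = ⟦⊙ᵖ⟧ (leaf s) q N x y inR
    ⟦⊙ᵖ⟧ (leaf s) (leaf t) N x y inR =
      trans (cong (if fits s t N x y then ⟦ s ⊙ˢ t ⟧ N x y else_) (⟦0ˢ⟧ N x y)) (sym (truncOp-⊙ s t N x y inR))

    compare-separable : (R : ℕ → ℕ → Bool) →
      (∀ s t → Separable (λ N x y → R (⟦ s ⟧ N x y) (⟦ t ⟧ N x y))) →
      ∀ p q → Separable (λ N x y → R (⟦ p ⟧ᵖ N x y) (⟦ q ⟧ᵖ N x y))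
    compare-separable R R-sep (leaf s) (leaf t) = R-sep s t
    compare-separable R R-sep (branch P sP p₁ p₂) q =
      separable-cong (λ N x y _ → if-distribˡ R (P N x y) _ _ _)
        (separable-∨ (separable-∧ sP (compare-separable R R-sep p₁ q))
                     (separable-∧ (separable-not sP) (compare-separable R R-sep p₂ q)))
    compare-separable R R-sep (leaf s) (branch P sP q₁ q₂) =
      separable-cong (λ N x y _ → if-distribʳ R (P N x y) _ _ _)
        (separable-∨ (separable-∧ sP (compare-separable R R-sep (leaf s) q₁))
                     (separable-∧ (separable-not sP) (compare-separable R R-sep (leaf s) q₂)))

    termPiecewise : Term σ (k + k) → Piecewise
    termPiecewise (var i)       = leaf ((varˡ ++ varʳ) i)
    termPiecewise (plus _ s t)  = termPiecewise s ⊙ᵖ termPiecewise t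
    termPiecewise (times _ s t) = termPiecewise s ⊙ᵖ termPiecewise t

    ⟦termPiecewise⟧ : ∀ t N x y → InRange N x y → ⟦ termPiecewise t ⟧ᵖ N x y ≡ evalTerm N (x ++ y) t
    ⟦termPiecewise⟧ (var i) N x y _ with splitAt k i
    ... | inj₁ j = ⟦varˡ⟧ j N x y
    ... | inj₂ j = ⟦varʳ⟧ j N x y
    ⟦termPiecewise⟧ (plus h s t) N x y inR =
      trans (⟦⊙ᵖ⟧ (termPiecewise s) (termPiecewise t) N x y inR) (cong (truncOp N)
        (trans (cong₂ _⊙_ (⟦termPiecewise⟧ s N x y inR) (⟦termPiecewise⟧ t N x y inR)) (sym (plus-is-⊙ h _ _))))
    ⟦termPiecewise⟧ (times h s t) N x y inR =
      trans (⟦⊙ᵖ⟧ (termPiecewise s) (termPiecewise t) N x y inR) (cong (truncOp N)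
        (trans (cong₂ _⊙_ (⟦termPiecewise⟧ s N x y inR) (⟦termPiecewise⟧ t N x y inR)) (sym (times-is-⊙ h _ _))))

    evalQF-separable : (φ : QF σ (k + k)) → Separable (λ N x y → evalQF N (x ++ y) φ)
    evalQF-separable (eq s t) =
      separable-cong (λ N x y inR → sym (cong₂ _≡ᵇ_ (⟦termPiecewise⟧ s N x y inR) (⟦termPiecewise⟧ t N x y inR)))
        (compare-separable _≡ᵇ_ ≡-separable (termPiecewise s) (termPiecewise t))
    evalQF-separable (lt _ s t) =
      separable-cong (λ N x y inR → sym (cong₂ _<ᵇ_ (⟦termPiecewise⟧ s N x y inR) (⟦termPiecewise⟧ t N x y inR)))
        (compare-separable _<ᵇ_ <-separable (termPiecewise s) (termPiecewise t))
    evalQF-separable (neg φ)   = separable-not (evalQF-separable φ)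
    evalQF-separable (or φ ψ)  = separable-∨ (evalQF-separable φ) (evalQF-separable ψ)
    evalQF-separable (and φ ψ) = separable-∧ (evalQF-separable φ) (evalQF-separable ψ)

  module OrderLabelling {σ} (φ : QF σ (k + k)) (sφ : Separable (λ N x y → evalQF N (x ++ y) φ)) where
    open Separable sφ

    width : ℕ
    width = 2 + (arityˡ + arityʳ)

    left right : Fin width → Fin (width + width)
    left j  = j ↑ˡ width
    right j = width ↑ʳ j

    flag₀ flag₁ : Fin width
    flag₀ = Fin.zero
    flag₁ = Fin.suc Fin.zero

    slotˡ : Fin arityˡ → Fin width
    slotˡ i = 2 ↑ʳ (i ↑ˡ arityʳ)

    slotʳ : Fin arityʳ → Fin width
    slotʳ i = 2 ↑ʳ (arityˡ ↑ʳ i)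

    slot : Fin arityˡ ⊎ Fin arityʳ → Fin (width + width)
    slot = [ left ∘ slotˡ , right ∘ slotʳ ]′

    -- Flags (0, 1) switch on the separating formula; a one-vertex graph instead gets
    -- flags (1, b) with b its loop bit, since its labels must lie in [1]₀.
    orderFormula : OrderFormula (Fin (width + width))
    orderFormula = or (and (lt (left flag₀) (left flag₁)) (rename slot formula))
                      (eq (left flag₀) (left flag₁))

    labels : (Fin 2 → ℕ) → (Fin arityˡ → ℕ) → (Fin arityʳ → ℕ) → Fin width → ℕ
    labels flags A B = flags ++ (A ++ B)

    labels-bounded : ∀ {M} flags A B → (∀ f → flags f ≤ M) → (∀ i → A i ≤ M) → (∀ i → B i ≤ M) →
      ∀ j → labels flags A B j ≤ M
    labels-bounded flags A B hf hA hB = ++-bounded flags _ hf (++-bounded A B hA hB)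

    degree′ : ℕ → ℕ
    degree′ c = suc c * degree

    graph : (n : ℕ) → (Fin n → Fin n → Bool) → Graph
    graph n ed = record { size = n ; edge = ed }

    InGr-orderFormula-one : ∀ c ed → InGr width (toQF orderFormula) (degree′ c) (graph 1 ed)
    InGr-orderFormula-one c ed = InGr-toQF orderFormula (degree′ c) (graph 1 ed) R R≤1 loop
      where
        flags : Fin 2 → ℕ
        flags Fin.zero    = 1
        flags (Fin.suc _) = if ed Fin.zero Fin.zero then 1 else 0
        flags≤1 : ∀ f → flags f ≤ 1
        flags≤1 Fin.zero = ≤-refl
        flags≤1 (Fin.suc _) with ed Fin.zero Fin.zero
        ... | true  = ≤-refl
        ... | false = z≤n
        R : Fin 1 → Fin width → ℕ
        R _ = labels flags (λ _ → 0) (λ _ → 0)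
        R≤1 : ∀ u j → R u j ≤ 1 ^ degree′ c
        R≤1 u j = ≤-trans (labels-bounded flags _ _ flags≤1 (λ _ → z≤n) (λ _ → z≤n) j)
                          (≤-reflexive (sym (^-zeroˡ (degree′ c))))
        loop : ∀ u v → ed u v ≡ evalOrd (R u ++ R v) orderFormula
        loop Fin.zero Fin.zero with ed Fin.zero Fin.zero
        ... | true  = refl
        ... | false = refl

    InGr-orderFormula-≥2 : ∀ c n ed → 2 ≤ n → InGr k φ c (graph n ed) →
      InGr width (toQF orderFormula) (degree′ c) (graph n ed)
    InGr-orderFormula-≥2 c n@(suc (suc _)) ed 2≤n@(s≤s (s≤s _)) (ℓ , edge≡) =
      InGr-toQF orderFormula (degree′ c) (graph n ed) R R≤ edge≡′
      where
        N = n ^ c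
        x : Fin n → Labels
        x u i = toℕ (ℓ u i)
        1≤N : 1 ≤ N
        1≤N = m^n>0 n c
        bounded : ∀ u → Bounded N (x u)
        bounded u i = ≤-pred (toℕ<n (ℓ u i))
        flags : Fin 2 → ℕ
        flags Fin.zero    = 0
        flags (Fin.suc _) = 1
        R : Fin n → Fin width → ℕ
        R u = labels flags (labelˡ N (x u)) (labelʳ N (x u))
        R≤ : ∀ u j → R u j ≤ n ^ degree′ c
        R≤ u = labels-bounded flags _ _
          (λ { Fin.zero → z≤n ; (Fin.suc _) → m^n>0 n (degree′ c) })
          (λ i → ≤-trans (labelˡ-bounded i N (x u) 1≤N (bounded u)) ([1+n^c]^e≤n^[1+c]e n c degree 2≤n))
          (λ i → ≤-trans (labelʳ-bounded i N (x u) 1≤N (bounded u)) ([1+n^c]^e≤n^[1+c]e n c degree 2≤n))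
        lookup-slot : ∀ u v w → (R u ++ R v) (slot w) ≡ [ labelˡ N (x u) , labelʳ N (x v) ]′ w
        lookup-slot u v (inj₁ i) = trans (lookup-++ˡ (R u) (R v) (slotˡ i))
          (lookup-++ˡ (labelˡ N (x u)) (labelʳ N (x u)) i)
        lookup-slot u v (inj₂ i) = trans (lookup-++ʳ (R u) (R v) (slotʳ i))
          (lookup-++ʳ (labelˡ N (x v)) (labelʳ N (x v)) i)
        edge≡′ : ∀ u v → ed u v ≡ evalOrd (R u ++ R v) orderFormula
        edge≡′ u v = begin
          ed u v                                                ≡⟨ edge≡ u v ⟩
          evalQF N (pairAssign k (ℓ u) (ℓ v)) φ                 ≡⟨ evalQF-cong N (pairAssign≗++ k (ℓ u) (ℓ v)) φ ⟩
          evalQF N (x u ++ x v) φ                               ≡⟨ sound N (x u) (x v) (1≤N , bounded u , bounded v) ⟩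
          evalOrd [ labelˡ N (x u) , labelʳ N (x v) ]′ formula  ≡⟨ evalOrd-cong (lookup-slot u v) formula ⟨
          evalOrd ((R u ++ R v) ∘ slot) formula                 ≡⟨ evalOrd-rename _ _ formula ⟨
          evalOrd (R u ++ R v) (rename slot formula)            ≡⟨ ∨-identityʳ _ ⟨
          evalOrd (R u ++ R v) orderFormula                     ∎
          where open ≡-Reasoning

    InGr-orderFormula : ∀ c n ed → InGr k φ c (graph n ed) → InGr width (toQF orderFormula) (degree′ c) (graph n ed)
    InGr-orderFormula c zero          ed _    = (λ ()) , λ ()
    InGr-orderFormula c (suc zero)    ed _    = InGr-orderFormula-one c ed
    InGr-orderFormula c (suc (suc n)) ed inGr = InGr-orderFormula-≥2 c (suc (suc n)) ed (s≤s (s≤s z≤n)) inGr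

InGFOqf-⇒σ< : ∀ {σ} → (∀ k → Separation.SplitModel k σ) → (C : Graph → Set) → InGFOqf σ C → InGFOqf σ< C
InGFOqf-⇒σ< M C (k , φ , c , inGr) =
  width , toQF orderFormula , degree′ c , λ G g → InGr-orderFormula c (size G) (edge G) (inGr G g)
  where
    open Separation k
    open OrderLabelling φ (Piecewise.evalQF-separable (M k) φ)

-- Sums

ShiftInvariant : (ℕ → ℕ → Bool) → Set
ShiftInvariant R = ∀ u v → R u v ≡ R (suc u) (suc v)

ShiftInvariant-+ : ∀ {R} → ShiftInvariant R → ∀ w u v → R u v ≡ R (w + u) (w + v)
ShiftInvariant-+ inv zero    u v = refl
ShiftInvariant-+ inv (suc w) u v = trans (ShiftInvariant-+ inv w u v) (inv (w + u) (w + v))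

-- Adding K to both sides and regrouping, with K = (K ∸ p′) + p′ = (K ∸ q) + q, cancels the common summand p′ + q.
separate-sums : ∀ {R} → ShiftInvariant R → ∀ p q p′ q′ K → p′ ≤ K → q ≤ K →
  R (p + q) (p′ + q′) ≡ R (p + (K ∸ p′)) (q′ + (K ∸ q))
separate-sums {R} inv p q p′ q′ K p′≤K q≤K = begin
  R (p + q) (p′ + q′)                                         ≡⟨ ShiftInvariant-+ inv K _ _ ⟩
  R (K + (p + q)) (K + (p′ + q′))                             ≡⟨ cong₂ R lhs rhs ⟩
  R ((p′ + q) + (p + (K ∸ p′))) ((p′ + q) + (q′ + (K ∸ q)))   ≡⟨ ShiftInvariant-+ inv (p′ + q) _ _ ⟨
  R (p + (K ∸ p′)) (q′ + (K ∸ q))                             ∎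
  where
    open ≡-Reasoning
    regroupˡ : ∀ p q p′ d → (d + p′) + (p + q) ≡ (p′ + q) + (p + d)
    regroupˡ = solve-∀
    regroupʳ : ∀ q p′ q′ d → (d + q) + (p′ + q′) ≡ (p′ + q) + (q′ + d)
    regroupʳ = solve-∀
    lhs : K + (p + q) ≡ (p′ + q) + (p + (K ∸ p′))
    lhs = trans (cong (_+ (p + q)) (sym (m∸n+n≡m p′≤K))) (regroupˡ p q p′ (K ∸ p′))
    rhs : K + (p′ + q′) ≡ (p′ + q) + (q′ + (K ∸ q))
    rhs = trans (cong (_+ (p′ + q′)) (sym (m∸n+n≡m q≤K))) (regroupʳ q p′ q′ (K ∸ q))

+≤ᵇ≡<ᵇ∸ : ∀ p q N → (p + q ≤ᵇ N) ≡ (p <ᵇ suc N ∸ q)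
+≤ᵇ≡<ᵇ∸ p q N = T-injective
  (λ t → <⇒<ᵇ (m+n≤o⇒m≤o∸n (suc p) (s≤s (≤ᵇ⇒≤ (p + q) N t))))
  (λ t → ≤⇒≤ᵇ (≤-pred (m≤o∸n⇒m+n≤o (suc p) (q≤1+N t) (<ᵇ⇒< p _ t))))
  where
    q≤1+N : T (p <ᵇ suc N ∸ q) → q ≤ suc N
    q≤1+N t with q ≤? suc N
    ... | yes q≤ = q≤
    ... | no q≰ = ⊥-elim (subst (λ z → T (p <ᵇ z)) (m≤n⇒m∸n≡0 (<⇒≤ (≰⇒> q≰))) t)

module SumModel (k : ℕ) where
  open Separation k

  record SumSplit : Set where
    field
      a b       : ℕ → Labels → ℕ
      degree    : ℕ
      a-bounded : PolyBounded a degree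
      b-bounded : PolyBounded b degree
  open SumSplit

  ⟦_⟧ : SumSplit → ℕ → Labels → Labels → ℕ
  ⟦ s ⟧ N x y = a s N x + b s N y

  module _ (s t : SumSplit) where
    private
      E : ℕ
      E = degree s ⊔ degree t
      aˢ-bounded : PolyBounded (a s) E
      aˢ-bounded = PolyBounded-mono (m≤m⊔n (degree s) (degree t)) (a-bounded s)
      bˢ-bounded : PolyBounded (b s) E
      bˢ-bounded = PolyBounded-mono (m≤m⊔n (degree s) (degree t)) (b-bounded s)
      aᵗ-bounded : PolyBounded (a t) E
      aᵗ-bounded = PolyBounded-mono (m≤n⊔m (degree s) (degree t)) (a-bounded t)
      bᵗ-bounded : PolyBounded (b t) E
      bᵗ-bounded = PolyBounded-mono (m≤n⊔m (degree s) (degree t)) (b-bounded t)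

    _⊕_ : SumSplit
    _⊕_ = record
      { a = λ N x → a s N x + a t N x
      ; b = λ N y → b s N y + b t N y
      ; degree = suc E
      ; a-bounded = PolyBounded-+ E aˢ-bounded aᵗ-bounded
      ; b-bounded = PolyBounded-+ E bˢ-bounded bᵗ-bounded
      }

    fits : Relation
    fits N x y = ⟦ _⊕_ ⟧ N x y ≤ᵇ N

    fits-separable : Separable fits
    fits-separable = separable-cong (λ N x y _ → +≤ᵇ≡<ᵇ∸ (a s N x + a t N x) (b s N y + b t N y) N)
      (separable-< (λ N x → a s N x + a t N x) (λ N y → suc N ∸ (b s N y + b t N y)) (suc E)
        (PolyBounded-+ E aˢ-bounded aᵗ-bounded)
        (λ N y _ _ → ≤-trans (m∸n≤m (suc N) (b s N y + b t N y)) (1+N≤[1+N]^[1+e] N E)))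

    truncOp-+ : ∀ N x y → truncOp N (⟦ s ⟧ N x y + ⟦ t ⟧ N x y) ≡ (if fits N x y then ⟦ _⊕_ ⟧ N x y else 0)
    truncOp-+ N x y = cong (truncOp N) (+-interchange (a s N x) (b s N y) (a t N x) (b t N y))

    compare-separable : ∀ R → ShiftInvariant R →
      (∀ (f g : ℕ → Labels → ℕ) e → PolyBounded f e → PolyBounded g e → Separable (λ N x y → R (f N x) (g N y))) →
      Separable (λ N x y → R (⟦ s ⟧ N x y) (⟦ t ⟧ N x y))
    compare-separable R inv separable-R = separable-cong
      (λ N x y (1≤N , bx , by) → separate-sums inv (a s N x) (b s N y) (a t N x) (b t N y) (K N)
         (aᵗ-bounded N x 1≤N bx) (bˢ-bounded N y 1≤N by))
      (separable-R (λ N x → a s N x + (K N ∸ a t N x)) (λ N y → b t N y + (K N ∸ b s N y)) (suc E)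
        (PolyBounded-+ E aˢ-bounded (λ N x _ _ → m∸n≤m (K N) (a t N x)))
        (PolyBounded-+ E bᵗ-bounded (λ N y _ _ → m∸n≤m (K N) (b s N y))))
      where
        K : ℕ → ℕ
        K N = suc N ^ E

  sumModel : SplitModel σ<+
  sumModel = record
    { _⊙_ = _+_
    ; plus-is-⊙ = λ _ _ _ → refl
    ; times-is-⊙ = λ ()
    ; Split = SumSplit
    ; ⟦_⟧ = ⟦_⟧
    ; varˡ = λ j → record { a = λ N x → x j ; b = λ _ _ → 0 ; degree = 1
                          ; a-bounded = PolyBounded-var j ; b-bounded = λ _ _ _ _ → z≤n }
    ; varʳ = λ j → record { a = λ _ _ → 0 ; b = λ N y → y j ; degree = 1
                          ; a-bounded = λ _ _ _ _ → z≤n ; b-bounded = PolyBounded-var j }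
    ; ⟦varˡ⟧ = λ j N x y → +-identityʳ (x j)
    ; ⟦varʳ⟧ = λ j N x y → refl
    ; 0ˢ = record { a = λ _ _ → 0 ; b = λ _ _ → 0 ; degree = 0
                  ; a-bounded = λ _ _ _ _ → z≤n ; b-bounded = λ _ _ _ _ → z≤n }
    ; ⟦0ˢ⟧ = λ N x y → refl
    ; _⊙ˢ_ = _⊕_
    ; fits = fits
    ; fits-separable = fits-separable
    ; truncOp-⊙ = λ s t N x y _ → truncOp-+ s t N x y
    ; <-separable = λ s t → compare-separable s t _<ᵇ_ (λ _ _ → refl) separable-<
    ; ≡-separable = λ s t → compare-separable s t _≡ᵇ_ (λ _ _ → refl) separable-≡
    }

-- Products

cap : ℕ → ℕ → ℕ
cap N v = v ⊓ suc N

cap≡ : ∀ {N P} → P ≤ suc N → cap N P ≡ P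
cap≡ = m≤n⇒m⊓n≡m

cap≤N⇒cap≡ : ∀ {N} P → cap N P ≤ N → cap N P ≡ P
cap≤N⇒cap≡ {N} P cap≤N with P ≤? suc N
... | yes P≤ = cap≡ P≤
... | no P≰ = ⊥-elim (<-irrefl refl (≤-trans (≤-reflexive (sym (m≥n⇒m⊓n≡n (<⇒≤ (≰⇒> P≰))))) cap≤N))

cap-*-cap : ∀ N P R → P * R ≤ N ⊎ cap N P * cap N R ≤ N → cap N P * cap N R ≡ P * R
cap-*-cap N zero    R       _ = refl
cap-*-cap N (suc p) zero    _ rewrite *-zeroʳ (cap N (suc p)) | *-zeroʳ p = refl
cap-*-cap N (suc p) (suc r) (inj₁ PR≤N) =
  cong₂ _*_ (cap≡ (≤-trans (m≤m*n (suc p) (suc r)) (≤-trans PR≤N (n≤1+n N))))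
            (cap≡ (≤-trans (m≤n*m (suc r) (suc p)) (≤-trans PR≤N (n≤1+n N))))
cap-*-cap N (suc p) (suc r) (inj₂ cPR≤N) =
  cong₂ _*_ (cap≤N⇒cap≡ (suc p) (≤-trans (m≤m*n (cap N (suc p)) (cap N (suc r))) cPR≤N))
            (cap≤N⇒cap≡ (suc r) (≤-trans (m≤n*m (cap N (suc r)) (cap N (suc p))) cPR≤N))

-- Whether P * R overflows N is decided by the capped factors, which stay below N + 2.
truncOp-*-cap : ∀ N P R → truncOp N (P * R) ≡ (if cap N P * cap N R ≤ᵇ N then cap N P * cap N R else 0)
truncOp-*-cap N P R with P * R ≤ᵇ N in PR≤ᵇN | cap N P * cap N R ≤ᵇ N in cPR≤ᵇN
... | true  | true  = sym (cap-*-cap N P R (inj₁ (≤ᵇ⇒≤ _ _ (Equivalence.from T-≡ PR≤ᵇN))))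
... | false | false = refl
... | true  | false = ⊥-elim (subst T cPR≤ᵇN (≤⇒≤ᵇ (≤-trans (≤-reflexive (cap-*-cap N P R (inj₁ PR≤N))) PR≤N)))
  where PR≤N = ≤ᵇ⇒≤ _ _ (Equivalence.from T-≡ PR≤ᵇN)
... | false | true  = ⊥-elim (subst T PR≤ᵇN (≤⇒≤ᵇ (≤-trans (≤-reflexive (sym (cap-*-cap N P R (inj₂ cPR≤N)))) cPR≤N)))
  where cPR≤N = ≤ᵇ⇒≤ _ _ (Equivalence.from T-≡ cPR≤ᵇN)

*≤⇒≤/ : ∀ u X d .{{_ : NonZero d}} → u * d ≤ X → u ≤ X / d
*≤⇒≤/ u X d u*d≤X = subst (_≤ X / d) (m*n/n≡m u d) (/-monoˡ-≤ d u*d≤X)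

-- The least u with u * v > N (junk value N + 2 when v = 0, where no such u exists).
productLimit : ℕ → ℕ → ℕ
productLimit N zero    = suc (suc N)
productLimit N (suc w) = suc (N / suc w)

*≤ᵇ≡<ᵇproductLimit : ∀ N u v → u ≤ suc N → (u * v ≤ᵇ N) ≡ (u <ᵇ productLimit N v)
*≤ᵇ≡<ᵇproductLimit N u zero u≤ rewrite *-zeroʳ u = sym (T-injective (λ _ → tt) (λ _ → <⇒<ᵇ (s≤s u≤)))
*≤ᵇ≡<ᵇproductLimit N u (suc w) _ = T-injective
  (λ t → <⇒<ᵇ (s≤s (*≤⇒≤/ u N (suc w) (≤ᵇ⇒≤ _ _ t))))
  (λ t → ≤⇒≤ᵇ (≤-trans (*-monoˡ-≤ (suc w) (≤-pred (<ᵇ⇒< u _ t))) (m/n*n≤m N (suc w))))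

productLimit≤[1+N]^2 : ∀ N v → 1 ≤ N → productLimit N v ≤ suc N ^ 2
productLimit≤[1+N]^2 N zero    1≤N = +-≤-[1+N]^[1+e] N 1 {1} {suc N} 1≤N
  (≤-trans (s≤s z≤n) (1+N≤[1+N]^[1+e] N 0)) (1+N≤[1+N]^[1+e] N 0)
productLimit≤[1+N]^2 N (suc w) _   = ≤-trans (s≤s (m/n≤m N (suc w))) (1+N≤[1+N]^[1+e] N 1)

-- The floor of (p / q) · (N + 1)²: for denominators at most N + 1 it separates distinct fractions.
ratio : ℕ → ℕ → ℕ → ℕ
ratio N p zero    = 0
ratio N p (suc q) = (p * (suc N * suc N)) / suc q

ratio≤[1+N]^3 : ∀ N p q → p ≤ suc N → ratio N p q ≤ suc N ^ 3
ratio≤[1+N]^3 N p zero    _   = z≤n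
ratio≤[1+N]^3 N p (suc q) p≤ = ≤-trans (m/n≤m (p * (suc N * suc N)) (suc q))
  (≤-trans (*-monoˡ-≤ (suc N * suc N) p≤) (≤-reflexive (cong (λ z → suc N * (suc N * z)) (sym (*-identityʳ (suc N))))))

ratio-mono : ∀ N p q r t .{{_ : NonZero q}} .{{_ : NonZero t}} → r * q ≤ p * t →
  (r * (suc N * suc N)) / t ≤ (p * (suc N * suc N)) / q
ratio-mono N p q r t rq≤pt = *≤⇒≤/ w (p * M) q (*-cancelʳ-≤ (w * q) (p * M) t (begin
  (w * q) * t    ≡⟨ swap w q t ⟩
  (w * t) * q    ≤⟨ *-monoˡ-≤ q (m/n*n≤m (r * M) t) ⟩
  (r * M) * q    ≡⟨ swap r M q ⟩
  (r * q) * M    ≤⟨ *-monoˡ-≤ M rq≤pt ⟩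
  (p * t) * M    ≡⟨ swap p t M ⟩
  (p * M) * t    ∎))
  where
    open ≤-Reasoning
    M = suc N * suc N
    w = (r * M) / t
    swap : ∀ a b c → (a * b) * c ≡ (a * c) * b
    swap = solve-∀

-- Strictness: the two fractions differ by at least 1 / (q t) ≥ 1 / M.
ratio-strict : ∀ N p q r t .{{_ : NonZero q}} .{{_ : NonZero t}} → q ≤ suc N → t ≤ suc N → p * t < r * q →
  (p * (suc N * suc N)) / q < (r * (suc N * suc N)) / t
ratio-strict N p q r t q≤ t≤ pt<rq = *≤⇒≤/ (suc u) (r * M) t (*-cancelʳ-≤ (suc u * t) (r * M) q (begin
  (suc u * t) * q         ≡⟨ expand u t q ⟩
  (u * q) * t + t * q     ≤⟨ +-mono-≤ (*-monoˡ-≤ t (m/n*n≤m (p * M) q)) (*-mono-≤ t≤ q≤) ⟩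
  (p * M) * t + M         ≡⟨ collect p M t ⟩
  suc (p * t) * M         ≤⟨ *-monoˡ-≤ M pt<rq ⟩
  (r * q) * M             ≡⟨ swap r q M ⟩
  (r * M) * q             ∎))
  where
    open ≤-Reasoning
    M = suc N * suc N
    u = (p * M) / q
    expand : ∀ u t q → (suc u * t) * q ≡ (u * q) * t + t * q
    expand = solve-∀
    collect : ∀ p M t → (p * M) * t + M ≡ suc (p * t) * M
    collect = solve-∀
    swap : ∀ a b c → (a * b) * c ≡ (a * c) * b
    swap = solve-∀

*<ᵇ*≡ratio<ᵇratio : ∀ N p q r t → suc q ≤ suc N → suc t ≤ suc N →
  (p * suc t <ᵇ r * suc q) ≡ (ratio N p (suc q) <ᵇ ratio N r (suc t))
*<ᵇ*≡ratio<ᵇratio N p q r t q≤ t≤ = T-injective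
  (λ pt<rq → <⇒<ᵇ (ratio-strict N p (suc q) r (suc t) q≤ t≤ (<ᵇ⇒< _ _ pt<rq)))
  (λ r< → <⇒<ᵇ (≰⇒> λ rq≤pt → <⇒≱ (<ᵇ⇒< _ _ r<) (ratio-mono N p (suc q) r (suc t) rq≤pt)))

*≡ᵇ*≡ratio≡ᵇratio : ∀ N p q r t → suc q ≤ suc N → suc t ≤ suc N →
  (p * suc t ≡ᵇ r * suc q) ≡ (ratio N p (suc q) ≡ᵇ ratio N r (suc t))
*≡ᵇ*≡ratio≡ᵇratio N p q r t q≤ t≤ = T-injective
  (λ pt≡rq → ≡⇒≡ᵇ _ _ (≤-antisym (ratio-mono N r (suc t) p (suc q) (≤-reflexive (≡ᵇ⇒≡ _ _ pt≡rq)))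
                                  (ratio-mono N p (suc q) r (suc t) (≤-reflexive (sym (≡ᵇ⇒≡ _ _ pt≡rq))))))
  (λ r≡ → ≡⇒≡ᵇ _ _ (ratio≡⇒*≡ (≡ᵇ⇒≡ _ _ r≡)))
  where
    ratio≡⇒*≡ : ratio N p (suc q) ≡ ratio N r (suc t) → p * suc t ≡ r * suc q
    ratio≡⇒*≡ r≡ with <-cmp (p * suc t) (r * suc q)
    ... | tri≈ _ pt≡rq _ = pt≡rq
    ... | tri< pt<rq _ _ = ⊥-elim (<-irrefl r≡ (ratio-strict N p (suc q) r (suc t) q≤ t≤ pt<rq))
    ... | tri> _ _ rq<pt = ⊥-elim (<-irrefl (sym r≡) (ratio-strict N r (suc t) p (suc q) t≤ q≤ rq<pt))

-- a b < a′ b′ compares a / a′ with b′ / b: each ratio involves only one of the two vertices.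
*<ᵇ*-by-ratio : ∀ N a b a′ b′ → a′ ≤ suc N → b ≤ suc N →
  (a * b <ᵇ a′ * b′) ≡
  ((not (a′ ≡ᵇ 0) ∧ not (0 ≡ᵇ b′)) ∧ (((a ≡ᵇ 0) ∨ (0 ≡ᵇ b)) ∨ (ratio N a a′ <ᵇ ratio N b′ b)))
*<ᵇ*-by-ratio N a       b       zero     b′       _  _  = refl
*<ᵇ*-by-ratio N a       b       (suc a′) zero     _  _  rewrite *-zeroʳ a′ = refl
*<ᵇ*-by-ratio N zero    b       (suc a′) (suc b′) _  _  = refl
*<ᵇ*-by-ratio N (suc a) zero    (suc a′) (suc b′) _  _  rewrite *-zeroʳ a = refl
*<ᵇ*-by-ratio N (suc a) (suc b) (suc a′) (suc b′) a′≤ b≤ =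
  trans (cong (suc a * suc b <ᵇ_) (*-comm (suc a′) (suc b′))) (*<ᵇ*≡ratio<ᵇratio N (suc a) a′ (suc b′) b a′≤ b≤)

*≡ᵇ*-by-ratio : ∀ N a b a′ b′ → a′ ≤ suc N → b ≤ suc N →
  (a * b ≡ᵇ a′ * b′) ≡
  ((((a ≡ᵇ 0) ∨ (0 ≡ᵇ b)) ∧ ((a′ ≡ᵇ 0) ∨ (0 ≡ᵇ b′))) ∨
   (((not (a ≡ᵇ 0) ∧ not (0 ≡ᵇ b)) ∧ (not (a′ ≡ᵇ 0) ∧ not (0 ≡ᵇ b′))) ∧ (ratio N a a′ ≡ᵇ ratio N b′ b)))
*≡ᵇ*-by-ratio N zero    b       zero     b′       _ _ = refl
*≡ᵇ*-by-ratio N zero    b       (suc a′) zero     _ _ rewrite *-zeroʳ a′ = refl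
*≡ᵇ*-by-ratio N zero    b       (suc a′) (suc b′) _ _ = refl
*≡ᵇ*-by-ratio N (suc a) zero    zero     b′       _ _ rewrite *-zeroʳ a = refl
*≡ᵇ*-by-ratio N (suc a) zero    (suc a′) zero     _ _ rewrite *-zeroʳ a | *-zeroʳ a′ = refl
*≡ᵇ*-by-ratio N (suc a) zero    (suc a′) (suc b′) _ _ rewrite *-zeroʳ a = refl
*≡ᵇ*-by-ratio N (suc a) (suc b) zero     b′       _ _ = refl
*≡ᵇ*-by-ratio N (suc a) (suc b) (suc a′) zero     _ _ rewrite *-zeroʳ a′ = refl
*≡ᵇ*-by-ratio N (suc a) (suc b) (suc a′) (suc b′) a′≤ b≤ =
  trans (cong (suc a * suc b ≡ᵇ_) (*-comm (suc a′) (suc b′))) (*≡ᵇ*≡ratio≡ᵇratio N (suc a) a′ (suc b′) b a′≤ b≤)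

module ProductModel (k : ℕ) where
  open Separation k

  Capped : (ℕ → Labels → ℕ) → Set
  Capped f = ∀ N x → 1 ≤ N → Bounded N x → f N x ≤ suc N

  Capped⇒PolyBounded : ∀ {f} e → Capped f → PolyBounded f (suc e)
  Capped⇒PolyBounded e hf N x h bd = ≤-trans (hf N x h bd) (1+N≤[1+N]^[1+e] N e)

  record ProductSplit : Set where
    field
      a b      : ℕ → Labels → ℕ
      a-capped : Capped a
      b-capped : Capped b
  open ProductSplit

  ⟦_⟧ : ProductSplit → ℕ → Labels → Labels → ℕ
  ⟦ s ⟧ N x y = a s N x * b s N y

  isZeroˡ : ∀ {f} → Capped f → Separable (λ N x y → f N x ≡ᵇ 0)
  isZeroˡ {f} hf = separable-≡ f (λ _ _ → 0) 3 (Capped⇒PolyBounded 2 hf) (λ _ _ _ _ → z≤n)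

  isZeroʳ : ∀ {g} → Capped g → Separable (λ N x y → 0 ≡ᵇ g N y)
  isZeroʳ {g} hg = separable-≡ (λ _ _ → 0) g 3 (λ _ _ _ _ → z≤n) (Capped⇒PolyBounded 2 hg)

  module _ (s t : ProductSplit) where
    _⊗_ : ProductSplit
    _⊗_ = record
      { a = λ N x → cap N (a s N x * a t N x)
      ; b = λ N y → cap N (b s N y * b t N y)
      ; a-capped = λ _ _ _ _ → m⊓n≤n _ _
      ; b-capped = λ _ _ _ _ → m⊓n≤n _ _
      }

    fits : Relation
    fits N x y = ⟦ _⊗_ ⟧ N x y ≤ᵇ N

    fits-separable : Separable fits
    fits-separable = separable-cong (λ N x y _ → *≤ᵇ≡<ᵇproductLimit N (a _⊗_ N x) (b _⊗_ N y) (m⊓n≤n _ _))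
      (separable-< (a _⊗_) (λ N y → productLimit N (b _⊗_ N y)) 2
        (Capped⇒PolyBounded 1 (a-capped _⊗_)) (λ N y 1≤N _ → productLimit≤[1+N]^2 N _ 1≤N))

    truncOp-* : ∀ N x y → truncOp N (⟦ s ⟧ N x y * ⟦ t ⟧ N x y) ≡ (if fits N x y then ⟦ _⊗_ ⟧ N x y else 0)
    truncOp-* N x y = trans (cong (truncOp N) (*-interchange (a s N x) (b s N y) (a t N x) (b t N y)))
                            (truncOp-*-cap N (a s N x * a t N x) (b s N y * b t N y))

    ratio-separable : ∀ (R : ℕ → ℕ → Bool) → (∀ (f g : ℕ → Labels → ℕ) e → PolyBounded f e → PolyBounded g e →
      Separable (λ N x y → R (f N x) (g N y))) →
      Separable (λ N x y → R (ratio N (a s N x) (a t N x)) (ratio N (b t N y) (b s N y)))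
    ratio-separable R separable-R = separable-R _ _ 3
      (λ N x 1≤N bd → ratio≤[1+N]^3 N (a s N x) (a t N x) (a-capped s N x 1≤N bd))
      (λ N y 1≤N bd → ratio≤[1+N]^3 N (b t N y) (b s N y) (b-capped t N y 1≤N bd))

    <-separable : Separable (λ N x y → ⟦ s ⟧ N x y <ᵇ ⟦ t ⟧ N x y)
    <-separable = separable-cong
      (λ N x y (1≤N , bx , by) → *<ᵇ*-by-ratio N (a s N x) (b s N y) (a t N x) (b t N y)
         (a-capped t N x 1≤N bx) (b-capped s N y 1≤N by))
      (separable-∧ (separable-∧ (separable-not (isZeroˡ (a-capped t))) (separable-not (isZeroʳ (b-capped t))))
                   (separable-∨ (separable-∨ (isZeroˡ (a-capped s)) (isZeroʳ (b-capped s)))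
                                (ratio-separable _<ᵇ_ separable-<)))

    ≡-separable : Separable (λ N x y → ⟦ s ⟧ N x y ≡ᵇ ⟦ t ⟧ N x y)
    ≡-separable = separable-cong
      (λ N x y (1≤N , bx , by) → *≡ᵇ*-by-ratio N (a s N x) (b s N y) (a t N x) (b t N y)
         (a-capped t N x 1≤N bx) (b-capped s N y 1≤N by))
      (separable-∨ (separable-∧ (separable-∨ (isZeroˡ (a-capped s)) (isZeroʳ (b-capped s)))
                                (separable-∨ (isZeroˡ (a-capped t)) (isZeroʳ (b-capped t))))
                   (separable-∧ (separable-∧ (separable-∧ (separable-not (isZeroˡ (a-capped s))) (separable-not (isZeroʳ (b-capped s))))
                                             (separable-∧ (separable-not (isZeroˡ (a-capped t))) (separable-not (isZeroʳ (b-capped t)))))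
                                (ratio-separable _≡ᵇ_ separable-≡)))

  productModel : SplitModel σ<×
  productModel = record
    { _⊙_ = _*_
    ; plus-is-⊙ = λ ()
    ; times-is-⊙ = λ _ _ _ → refl
    ; Split = ProductSplit
    ; ⟦_⟧ = ⟦_⟧
    ; varˡ = λ j → record { a = λ N x → x j ; b = λ _ _ → 1
                          ; a-capped = λ N x _ bd → ≤-trans (bd j) (n≤1+n N) ; b-capped = λ _ _ _ _ → s≤s z≤n }
    ; varʳ = λ j → record { a = λ _ _ → 1 ; b = λ N y → y j
                          ; a-capped = λ _ _ _ _ → s≤s z≤n ; b-capped = λ N y _ bd → ≤-trans (bd j) (n≤1+n N) }
    ; ⟦varˡ⟧ = λ j N x y → *-identityʳ (x j)
    ; ⟦varʳ⟧ = λ j N x y → *-identityˡ (y j)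
    ; 0ˢ = record { a = λ _ _ → 0 ; b = λ _ _ → 0 ; a-capped = λ _ _ _ _ → z≤n ; b-capped = λ _ _ _ _ → z≤n }
    ; ⟦0ˢ⟧ = λ N x y → refl
    ; _⊙ˢ_ = _⊗_
    ; fits = fits
    ; fits-separable = fits-separable
    ; truncOp-⊙ = λ s t N x y _ → truncOp-* s t N x y
    ; <-separable = <-separable
    ; ≡-separable = ≡-separable
    }

theorem6p11 : (C : Graph → Set) → IsoClosed C →
    (InGFOqf σ< C ⇔ InGFOqf σ<+ C) × (InGFOqf σ< C ⇔ InGFOqf σ<× C)
theorem6p11 C _ =
  mk⇔ (InGFOqf-σ<⇒ σ<+ tt C) (InGFOqf-⇒σ< SumModel.sumModel C) ,
  mk⇔ (InGFOqf-σ<⇒ σ<× tt C) (InGFOqf-⇒σ< ProductModel.productModel C)
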